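{- Let $P$ be a connected finite poset with at least two points and let $C\subseteq E(P)$ be a 4-crown of $P$ with $L(C)=\{a,b\}$, $U(C)=\{v,w\}$. The following are equivalent: (i) there exists a $C$-separating homomorphism $\phi:\mathfrak{F}(P)\to\mathfrak{C}$; (ii) there exists a $C$-separating homomorphism $\psi:\mathfrak{F}(P)\to\mathfrak{C}$ with $\psi(F)=S$ for all $S\in\mathcal{C}_3$ and all $F\in\mathcal{F}(P)_S$; (iii) there exists a $C$-separating homomorphism from $\mathfrak{F}(P)$ to $\mathfrak{C}_3$ with the property stated in (ii).
   Context: All posets are finite; subsets are identified with induced subposets. $L(P)$, $U(P)$: minimal and maximal points of $P$; $E(P)=L(P)\cup U(P)$. $[x,y]_P=\{z: x\leq_P z\leq_P y\}$. A crown is a subset whose comparability graph is a cycle; a 4-crown $D=\{a,b,v,w\}$ with $L(D)=\{a,b\}$, $U(D)=\{v,w\}$ is improper if $[a,v]_P\cap[b,w]_P\neq\emptyset$. $\mathcal{C}_{23}$: the subsets of $C$ with 2 or 3 elements which are connected as induced subposets of $C$ (the four comparable pairs and $abv,abw,avw,bvw$, where $xyz=\{x,y,z\}$). $\mathfrak{C}$: multigraph on $\mathcal{C}_{23}$ with an L-edge between $S,T$ (loops allowed) iff $L(C)\cap S\cap T\neq\emptyset$ and a U-edge iff $U(C)\cap S\cap T\neq\emptyset$. $\mathcal{C}_3=\{S\in\mathcal{C}_{23}:\#S=3\}$ and $\mathfrak{C}_3$ is the sub-multigraph induced by $\mathcal{C}_3$. $\mathcal{A},\mathcal{B},\mathcal{V},\mathcal{W}$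 are the sets of $S\in\mathcal{C}_{23}$ with $L(C)\cap S=\{a\}$, $L(C)\cap S=\{b\}$, $U(C)\cap S=\{v\}$, $U(C)\cap S=\{w\}$ respectively. $\mathcal{F}(P)$: the set of improper 4-crowns of $P$ contained in $E(P)$; for $S\in\mathcal{C}_3$, $\mathcal{F}(P)_S=\{F\in\mathcal{F}(P): S\subseteq F\}$. $\mathfrak{F}(P)$: multigraph on $\mathcal{F}(P)$ with L-edge between $F,G$ iff $L(P)\cap F\cap G\neq\emptyset$ and U-edge iff $U(P)\cap F\cap G\neq\emptyset$. A homomorphism from $\mathfrak{F}(P)$ to $\mathfrak{C}$ (resp. $\mathfrak{C}_3$) is a map $\mathcal{F}(P)\to\mathcal{C}_{23}$ (resp. $\to\mathcal{C}_3$) sending L-edges to L-edges and U-edges to U-edges. It is $C$-separating if there exist $x\neq x'$ in $L(P)$ and $y\neq y'$ in $U(P)$ with $\{x,x',y,y'\}=C$ such that for all $F\in\mathcal{F}(P)$: $x\in F\Rightarrow\phi(F)\notin\mathcal{A}$; $x'\in F\Rightarrow\phi(F)\notin\mathcal{B}$; $y\in F\Rightarrow\phi(F)\notin\mathcal{V}$; $y'\in F\Rightarrow\phi(F)\notin\mathcal{W}$. -}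

module Defs where

open import Level using (0ℓ)
open import Data.Nat using (ℕ)
open import Data.Bool using (Bool; true; false)
open import Data.Fin using (Fin)
open import Data.Fin.Subset using (Subset; ⁅_⁆; _∪_; _∈_; _⊆_)
open import Data.Product using (Σ; ∃; _×_; _,_)
open import Data.Sum using (_⊎_)
open import Data.Unit using (⊤)
open import Data.Empty using (⊥)
open import Relation.Nullary using (¬_)
open import Relation.Binary using (Rel)
open import Relation.Binary.PropositionalEquality using (_≡_; _≢_)
open import Relation.Binary.Construct.Closure.ReflexiveTransitive using (Star)

data C23 : Set where
  av aw bv bw abv abw avw bvw : C23

hasA hasB hasV hasW : C23 → Bool
hasA av = true
hasA aw = true
hasA abv = true
hasA abw = true
hasA avw = true
hasA _ = false
hasB bv = true
hasB bw = true
hasB abv = true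
hasB abw = true
hasB bvw = true
hasB _ = false
hasV av = true
hasV bv = true
hasV abv = true
hasV avw = true
hasV bvw = true
hasV _ = false
hasW aw = true
hasW bw = true
hasW abw = true
hasW avw = true
hasW bvw = true
hasW _ = false

IsC3 : C23 → Set
IsC3 abv = ⊤
IsC3 abw = ⊤
IsC3 avw = ⊤
IsC3 bvw = ⊤
IsC3 _ = ⊥

LEdgeC : C23 → C23 → Set
LEdgeC S T = (hasA S ≡ true × hasA T ≡ true) ⊎ (hasB S ≡ true × hasB T ≡ true)

UEdgeC : C23 → C23 → Set
UEdgeC S T = (hasV S ≡ true × hasV T ≡ true) ⊎ (hasW S ≡ true × hasW T ≡ true)

In𝒜 In𝓑 In𝒱 In𝒲 : C23 → Set
In𝒜 S = hasA S ≡ true × hasB S ≡ false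
In𝓑 S = hasB S ≡ true × hasA S ≡ false
In𝒱 S = hasV S ≡ true × hasW S ≡ false
In𝒲 S = hasW S ≡ true × hasV S ≡ false

quad : ∀ {n} → Fin n → Fin n → Fin n → Fin n → Subset n
quad a b v w = ⁅ a ⁆ ∪ ⁅ b ⁆ ∪ ⁅ v ⁆ ∪ ⁅ w ⁆

toSub : ∀ {n} → Fin n → Fin n → Fin n → Fin n → C23 → Subset n
toSub a b v w av = ⁅ a ⁆ ∪ ⁅ v ⁆
toSub a b v w aw = ⁅ a ⁆ ∪ ⁅ w ⁆
toSub a b v w bv = ⁅ b ⁆ ∪ ⁅ v ⁆
toSub a b v w bw = ⁅ b ⁆ ∪ ⁅ w ⁆
toSub a b v w abv = ⁅ a ⁆ ∪ ⁅ b ⁆ ∪ ⁅ v ⁆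
toSub a b v w abw = ⁅ a ⁆ ∪ ⁅ b ⁆ ∪ ⁅ w ⁆
toSub a b v w avw = ⁅ a ⁆ ∪ ⁅ v ⁆ ∪ ⁅ w ⁆
toSub a b v w bvw = ⁅ b ⁆ ∪ ⁅ v ⁆ ∪ ⁅ w ⁆

module _ {n : ℕ} (_≤_ : Rel (Fin n) 0ℓ) where

  Comparable : Rel (Fin n) 0ℓ
  Comparable x y = (x ≤ y) ⊎ (y ≤ x)

  Connected : Set
  Connected = ∀ x y → Star Comparable x y

  IsMin : Fin n → Set
  IsMin x = ∀ y → y ≤ x → y ≡ x

  IsMax : Fin n → Set
  IsMax x = ∀ y → x ≤ y → y ≡ x

  InE : Fin n → Set
  InE x = IsMin x ⊎ IsMax x

  record Is4Crown (a b v w : Fin n) : Set where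
    field
      a≢v : a ≢ v
      a≢w : a ≢ w
      b≢v : b ≢ v
      b≢w : b ≢ w
      a≢b : a ≢ b
      v≢w : v ≢ w
      a≤v : a ≤ v
      a≤w : a ≤ w
      b≤v : b ≤ v
      b≤w : b ≤ w
      a≰b : ¬ (a ≤ b)
      b≰a : ¬ (b ≤ a)
      v≰w : ¬ (v ≤ w)
      w≰v : ¬ (w ≤ v)

  Improper : Fin n → Fin n → Fin n → Fin n → Set
  Improper a b v w = ∃ λ z → (a ≤ z × z ≤ v) × (b ≤ z × z ≤ w)

  InF : Subset n → Set
  InF D = Σ (Fin n) λ a → Σ (Fin n) λ b → Σ (Fin n) λ v → Σ (Fin n) λ w →
            D ≡ quad a b v w × Is4Crown a b v w ×
            (InE a × InE b × InE v × InE w) × Improper a b v w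

  LEdgeF : Subset n → Subset n → Set
  LEdgeF F G = ∃ λ x → IsMin x × x ∈ F × x ∈ G

  UEdgeF : Subset n → Subset n → Set
  UEdgeF F G = ∃ λ x → IsMax x × x ∈ F × x ∈ G

  IsHom : (Subset n → C23) → Set
  IsHom φ = ∀ F G → InF F → InF G →
              (LEdgeF F G → LEdgeC (φ F) (φ G)) × (UEdgeF F G → UEdgeC (φ F) (φ G))

  -- φ takes values in 𝒞₃ on 𝓕(P) (homomorphism into ℭ₃ = induced sub-multigraph)
  IntoC3 : (Subset n → C23) → Set
  IntoC3 φ = ∀ F → InF F → IsC3 (φ F)

  Separating : Fin n → Fin n → Fin n → Fin n → (Subset n → C23) → Set
  Separating a b v w φ =
    Σ (Fin n) λ x → Σ (Fin n) λ x' → Σ (Fin n) λ y → Σ (Fin n) λ y' →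
      x ≢ x' × IsMin x × IsMin x' × y ≢ y' × IsMax y × IsMax y' ×
      quad x x' y y' ≡ quad a b v w ×
      (∀ F → InF F →
         (x ∈ F → ¬ In𝒜 (φ F)) × (x' ∈ F → ¬ In𝓑 (φ F)) ×
         (y ∈ F → ¬ In𝒱 (φ F)) × (y' ∈ F → ¬ In𝒲 (φ F)))

  FixesC3 : Fin n → Fin n → Fin n → Fin n → (Subset n → C23) → Set
  FixesC3 a b v w ψ = ∀ S → IsC3 S → ∀ F → InF F → toSub a b v w S ⊆ F → ψ F ≡ S

-- Up to the two symmetries of the crown (exchanging a with b, and v with w),
-- which act on ℭ by automorphisms, the separating points may be taken to be
-- x = b, x' = a, y = w, y' = v.  Then φ is improved to a map into ℭ₃ by sending
-- each comparable pair to the 3-element set obtained by adding the other minimal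
-- point of C; this map preserves both kinds of edges and creates no new member
-- of 𝒜, ℬ, 𝒱, 𝒲.  If F contains S ∈ 𝒞₃, separation forbids three of the four
-- classes for ψ(F), and S is the only member of 𝒞₃ outside all three, so ψ(F) = S.
module Submission where

open import Defs
open import Level using (0ℓ)
open import Data.Nat using (ℕ; _≤_)
open import Data.Bool using (Bool; true; false)
open import Data.Fin using (Fin)
open import Data.Fin.Subset using (Subset; ⁅_⁆; _∪_; _∈_)
open import Data.Fin.Subset.Properties
  using (x∈⁅x⁆; x∈⁅y⁆⇒x≡y; x∈p∪q⁻; p⊆p∪q; q⊆p∪q; ∪-comm; ∪-assoc)
open import Data.Product using (Σ; _×_; _,_; proj₁; proj₂)
open import Data.Sum using (_⊎_; inj₁; inj₂)
open import Data.Unit using (tt)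
open import Data.Empty using (⊥-elim)
open import Function using (_∘_; id)
open import Relation.Nullary using (¬_)
open import Relation.Binary using (Rel; IsPartialOrder)
open import Relation.Binary.PropositionalEquality
  using (_≡_; _≢_; refl; sym; trans; cong; subst; module ≡-Reasoning)
open import Function.Bundles using (_⇔_; mk⇔)

data Corner : Set where
  ca cb cv cw : Corner

has : Corner → C23 → Bool
has ca = hasA
has cb = hasB
has cv = hasV
has cw = hasW

partner : Corner → Corner
partner ca = cb
partner cb = ca
partner cv = cw
partner cw = cv

-- Only ca, Only cb, Only cv, Only cw unfold to In𝒜, In𝓑, In𝒱, In𝒲.
Only : Corner → C23 → Set
Only c S = has c S ≡ true × has (partner c) S ≡ false

PreservesEdges : (C23 → C23) → Set
PreservesEdges σ = ∀ {S T} → (LEdgeC S T → LEdgeC (σ S) (σ T)) × (UEdgeC S T → UEdgeC (σ S) (σ T))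

ReflectsOnly : (C23 → C23) → (Corner → Corner) → Set
ReflectsOnly σ π = ∀ S c → Only c (σ S) → Only (π c) S

Monotone : (C23 → C23) → Set
Monotone σ = ∀ S c → has c S ≡ true → has c (σ S) ≡ true

Monotone⇒PreservesEdges : ∀ {σ} → Monotone σ → PreservesEdges σ
Monotone⇒PreservesEdges {σ} mono {S} {T} = L , U
  where
  L : LEdgeC S T → LEdgeC (σ S) (σ T)
  L (inj₁ (p , q)) = inj₁ (mono S ca p , mono T ca q)
  L (inj₂ (p , q)) = inj₂ (mono S cb p , mono T cb q)
  U : UEdgeC S T → UEdgeC (σ S) (σ T)
  U (inj₁ (p , q)) = inj₁ (mono S cv p , mono T cv q)
  U (inj₂ (p , q)) = inj₂ (mono S cw p , mono T cw q)

module Relabelling (σ : C23 → C23) (π : Corner → Corner)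
  (has-σ : ∀ S c → has c (σ S) ≡ has (π c) S)
  (π-partner : ∀ c → π (partner c) ≡ partner (π c)) where

  reflectsOnly : ReflectsOnly σ π
  reflectsOnly S c (p , q) =
    trans (sym (has-σ S c)) p ,
    trans (cong (λ d → has d S) (sym (π-partner c))) (trans (sym (has-σ S (partner c))) q)

swapLower swapUpper : C23 → C23
swapLower av = bv
swapLower bv = av
swapLower aw = bw
swapLower bw = aw
swapLower abv = abv
swapLower abw = abw
swapLower avw = bvw
swapLower bvw = avw
swapUpper av = aw
swapUpper aw = av
swapUpper bv = bw
swapUpper bw = bv
swapUpper abv = abw
swapUpper abw = abv
swapUpper avw = avw
swapUpper bvw = bvw

swapLowerCorner swapUpperCorner : Corner → Corner
swapLowerCorner ca = cb
swapLowerCorner cb = ca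
swapLowerCorner c = c
swapUpperCorner cv = cw
swapUpperCorner cw = cv
swapUpperCorner c = c

every-corner : {P : Corner → Set} → P ca → P cb → P cv → P cw → ∀ c → P c
every-corner pa pb pv pw ca = pa
every-corner pa pb pv pw cb = pb
every-corner pa pb pv pw cv = pv
every-corner pa pb pv pw cw = pw

has-swapLower : ∀ S c → has c (swapLower S) ≡ has (swapLowerCorner c) S
has-swapLower av = every-corner refl refl refl refl
has-swapLower bv = every-corner refl refl refl refl
has-swapLower aw = every-corner refl refl refl refl
has-swapLower bw = every-corner refl refl refl refl
has-swapLower abv = every-corner refl refl refl refl
has-swapLower abw = every-corner refl refl refl refl
has-swapLower avw = every-corner refl refl refl refl
has-swapLower bvw = every-corner refl refl refl refl

has-swapUpper : ∀ S c → has c (swapUpper S) ≡ has (swapUpperCorner c) S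
has-swapUpper av = every-corner refl refl refl refl
has-swapUpper bv = every-corner refl refl refl refl
has-swapUpper aw = every-corner refl refl refl refl
has-swapUpper bw = every-corner refl refl refl refl
has-swapUpper abv = every-corner refl refl refl refl
has-swapUpper abw = every-corner refl refl refl refl
has-swapUpper avw = every-corner refl refl refl refl
has-swapUpper bvw = every-corner refl refl refl refl

swapLower-reflectsOnly : ReflectsOnly swapLower swapLowerCorner
swapLower-reflectsOnly =
  Relabelling.reflectsOnly swapLower swapLowerCorner has-swapLower (every-corner refl refl refl refl)

swapUpper-reflectsOnly : ReflectsOnly swapUpper swapUpperCorner
swapUpper-reflectsOnly =
  Relabelling.reflectsOnly swapUpper swapUpperCorner has-swapUpper (every-corner refl refl refl refl)

swapLower-preservesEdges : PreservesEdges swapLower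
swapLower-preservesEdges {S} {T} = L , U
  where
  L : LEdgeC S T → LEdgeC (swapLower S) (swapLower T)
  L (inj₁ (p , q)) = inj₂ (trans (has-swapLower S cb) p , trans (has-swapLower T cb) q)
  L (inj₂ (p , q)) = inj₁ (trans (has-swapLower S ca) p , trans (has-swapLower T ca) q)
  U : UEdgeC S T → UEdgeC (swapLower S) (swapLower T)
  U (inj₁ (p , q)) = inj₁ (trans (has-swapLower S cv) p , trans (has-swapLower T cv) q)
  U (inj₂ (p , q)) = inj₂ (trans (has-swapLower S cw) p , trans (has-swapLower T cw) q)

swapUpper-preservesEdges : PreservesEdges swapUpper
swapUpper-preservesEdges {S} {T} = L , U
  where
  L : LEdgeC S T → LEdgeC (swapUpper S) (swapUpper T)
  L (inj₁ (p , q)) = inj₁ (trans (has-swapUpper S ca) p , trans (has-swapUpper T ca) q)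
  L (inj₂ (p , q)) = inj₂ (trans (has-swapUpper S cb) p , trans (has-swapUpper T cb) q)
  U : UEdgeC S T → UEdgeC (swapUpper S) (swapUpper T)
  U (inj₁ (p , q)) = inj₂ (trans (has-swapUpper S cw) p , trans (has-swapUpper T cw) q)
  U (inj₂ (p , q)) = inj₁ (trans (has-swapUpper S cv) p , trans (has-swapUpper T cv) q)

fillLower : C23 → C23
fillLower av = abv
fillLower bv = abv
fillLower aw = abw
fillLower bw = abw
fillLower S = S

fillLower-IsC3 : ∀ S → IsC3 (fillLower S)
fillLower-IsC3 av = tt
fillLower-IsC3 bv = tt
fillLower-IsC3 aw = tt
fillLower-IsC3 bw = tt
fillLower-IsC3 abv = tt
fillLower-IsC3 abw = tt
fillLower-IsC3 avw = tt
fillLower-IsC3 bvw = tt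

fillLower-monotone : Monotone fillLower
fillLower-monotone av = every-corner (λ _ → refl) (λ _ → refl) (λ _ → refl) (λ ())
fillLower-monotone bv = every-corner (λ _ → refl) (λ _ → refl) (λ _ → refl) (λ ())
fillLower-monotone aw = every-corner (λ _ → refl) (λ _ → refl) (λ ()) (λ _ → refl)
fillLower-monotone bw = every-corner (λ _ → refl) (λ _ → refl) (λ ()) (λ _ → refl)
fillLower-monotone abv _ = id
fillLower-monotone abw _ = id
fillLower-monotone avw _ = id
fillLower-monotone bvw _ = id

fillLower-reflectsOnly : ReflectsOnly fillLower id
fillLower-reflectsOnly av = every-corner (λ ()) (λ ()) (λ _ → refl , refl) (λ ())
fillLower-reflectsOnly bv = every-corner (λ ()) (λ ()) (λ _ → refl , refl) (λ ())
fillLower-reflectsOnly aw = every-corner (λ ()) (λ ()) (λ ()) (λ _ → refl , refl)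
fillLower-reflectsOnly bw = every-corner (λ ()) (λ ()) (λ ()) (λ _ → refl , refl)
fillLower-reflectsOnly abv _ = id
fillLower-reflectsOnly abw _ = id
fillLower-reflectsOnly avw _ = id
fillLower-reflectsOnly bvw _ = id

C3-pinned : ∀ S T → IsC3 S → IsC3 T → (∀ c → has c S ≡ true → ¬ Only (partner c) T) → T ≡ S
C3-pinned _ av _ () _
C3-pinned _ bv _ () _
C3-pinned _ aw _ () _
C3-pinned _ bw _ () _
C3-pinned av _ () _ _
C3-pinned bv _ () _ _
C3-pinned aw _ () _ _
C3-pinned bw _ () _ _
C3-pinned abv abv _ _ _ = refl
C3-pinned abv abw _ _ h = ⊥-elim (h cv refl (refl , refl))
C3-pinned abv avw _ _ h = ⊥-elim (h cb refl (refl , refl))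
C3-pinned abv bvw _ _ h = ⊥-elim (h ca refl (refl , refl))
C3-pinned abw abv _ _ h = ⊥-elim (h cw refl (refl , refl))
C3-pinned abw abw _ _ _ = refl
C3-pinned abw avw _ _ h = ⊥-elim (h cb refl (refl , refl))
C3-pinned abw bvw _ _ h = ⊥-elim (h ca refl (refl , refl))
C3-pinned avw abv _ _ h = ⊥-elim (h cw refl (refl , refl))
C3-pinned avw abw _ _ h = ⊥-elim (h cv refl (refl , refl))
C3-pinned avw avw _ _ _ = refl
C3-pinned avw bvw _ _ h = ⊥-elim (h ca refl (refl , refl))
C3-pinned bvw abv _ _ h = ⊥-elim (h cw refl (refl , refl))
C3-pinned bvw abw _ _ h = ⊥-elim (h cv refl (refl , refl))
C3-pinned bvw avw _ _ h = ⊥-elim (h cb refl (refl , refl))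
C3-pinned bvw bvw _ _ _ = refl

distinct-in-pair : ∀ {A : Set} {x x' a b : A} → x ≢ x' → x ≡ a ⊎ x ≡ b → x' ≡ a ⊎ x' ≡ b →
                   (x ≡ a × x' ≡ b) ⊎ (x ≡ b × x' ≡ a)
distinct-in-pair x≢x' (inj₁ refl) (inj₁ refl) = ⊥-elim (x≢x' refl)
distinct-in-pair x≢x' (inj₁ p) (inj₂ q) = inj₁ (p , q)
distinct-in-pair x≢x' (inj₂ p) (inj₁ q) = inj₂ (p , q)
distinct-in-pair x≢x' (inj₂ refl) (inj₂ refl) = ⊥-elim (x≢x' refl)

module _ {n : ℕ} where

  corner : Fin n → Fin n → Fin n → Fin n → Corner → Fin n
  corner a b v w ca = a
  corner a b v w cb = b
  corner a b v w cv = v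
  corner a b v w cw = w

  ∈-head : ∀ {x} {q : Subset n} → x ∈ ⁅ x ⁆ ∪ q
  ∈-head {x} = p⊆p∪q _ (x∈⁅x⁆ x)

  ∈-tail : ∀ {x} {p q : Subset n} → x ∈ q → x ∈ p ∪ q
  ∈-tail {p = p} = q⊆p∪q p _

  corner-∈-quad : ∀ a b v w c → corner a b v w c ∈ quad a b v w
  corner-∈-quad a b v w ca = ∈-head
  corner-∈-quad a b v w cb = ∈-tail ∈-head
  corner-∈-quad a b v w cv = ∈-tail (∈-tail ∈-head)
  corner-∈-quad a b v w cw = ∈-tail (∈-tail (∈-tail (x∈⁅x⁆ w)))

  ∈-quad⁻ : ∀ {x} a b v w → x ∈ quad a b v w → Σ Corner λ c → x ≡ corner a b v w c
  ∈-quad⁻ a b v w x∈ with x∈p∪q⁻ ⁅ a ⁆ _ x∈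
  ... | inj₁ x∈a = ca , x∈⁅y⁆⇒x≡y a x∈a
  ... | inj₂ x∈bvw with x∈p∪q⁻ ⁅ b ⁆ _ x∈bvw
  ...   | inj₁ x∈b = cb , x∈⁅y⁆⇒x≡y b x∈b
  ...   | inj₂ x∈vw with x∈p∪q⁻ ⁅ v ⁆ _ x∈vw
  ...     | inj₁ x∈v = cv , x∈⁅y⁆⇒x≡y v x∈v
  ...     | inj₂ x∈w = cw , x∈⁅y⁆⇒x≡y w x∈w

  has⇒corner-∈-toSub : ∀ a b v w S c → has c S ≡ true → corner a b v w c ∈ toSub a b v w S
  has⇒corner-∈-toSub a b v w av = every-corner (λ _ → ∈-head) (λ ()) (λ _ → ∈-tail (x∈⁅x⁆ v)) (λ ())
  has⇒corner-∈-toSub a b v w bv = every-corner (λ ()) (λ _ → ∈-head) (λ _ → ∈-tail (x∈⁅x⁆ v)) (λ ())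
  has⇒corner-∈-toSub a b v w aw = every-corner (λ _ → ∈-head) (λ ()) (λ ()) (λ _ → ∈-tail (x∈⁅x⁆ w))
  has⇒corner-∈-toSub a b v w bw = every-corner (λ ()) (λ _ → ∈-head) (λ ()) (λ _ → ∈-tail (x∈⁅x⁆ w))
  has⇒corner-∈-toSub a b v w abv =
    every-corner (λ _ → ∈-head) (λ _ → ∈-tail ∈-head) (λ _ → ∈-tail (∈-tail (x∈⁅x⁆ v))) (λ ())
  has⇒corner-∈-toSub a b v w abw =
    every-corner (λ _ → ∈-head) (λ _ → ∈-tail ∈-head) (λ ()) (λ _ → ∈-tail (∈-tail (x∈⁅x⁆ w)))
  has⇒corner-∈-toSub a b v w avw =
    every-corner (λ _ → ∈-head) (λ ()) (λ _ → ∈-tail ∈-head) (λ _ → ∈-tail (∈-tail (x∈⁅x⁆ w)))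
  has⇒corner-∈-toSub a b v w bvw =
    every-corner (λ ()) (λ _ → ∈-head) (λ _ → ∈-tail ∈-head) (λ _ → ∈-tail (∈-tail (x∈⁅x⁆ w)))

  quad-swap : ∀ (a b v w : Fin n) → quad b a w v ≡ quad a b v w
  quad-swap a b v w = begin
    ⁅ b ⁆ ∪ ⁅ a ⁆ ∪ ⁅ w ⁆ ∪ ⁅ v ⁆     ≡⟨ cong (λ r → ⁅ b ⁆ ∪ ⁅ a ⁆ ∪ r) (∪-comm ⁅ w ⁆ ⁅ v ⁆) ⟩
    ⁅ b ⁆ ∪ ⁅ a ⁆ ∪ ⁅ v ⁆ ∪ ⁅ w ⁆     ≡⟨ sym (∪-assoc ⁅ b ⁆ ⁅ a ⁆ _) ⟩
    (⁅ b ⁆ ∪ ⁅ a ⁆) ∪ ⁅ v ⁆ ∪ ⁅ w ⁆   ≡⟨ cong (_∪ (⁅ v ⁆ ∪ ⁅ w ⁆)) (∪-comm ⁅ b ⁆ ⁅ a ⁆) ⟩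
    (⁅ a ⁆ ∪ ⁅ b ⁆) ∪ ⁅ v ⁆ ∪ ⁅ w ⁆   ≡⟨ ∪-assoc ⁅ a ⁆ ⁅ b ⁆ _ ⟩
    ⁅ a ⁆ ∪ ⁅ b ⁆ ∪ ⁅ v ⁆ ∪ ⁅ w ⁆     ∎
    where open ≡-Reasoning

  corner-partner : ∀ (a b v w : Fin n) c → corner b a w v (partner c) ≡ corner a b v w c
  corner-partner a b v w = every-corner refl refl refl refl

module _ {n : ℕ} (_≼_ : Rel (Fin n) 0ℓ) where

  IsHom-∘ : ∀ {σ φ} → PreservesEdges σ → IsHom _≼_ φ → IsHom _≼_ (σ ∘ φ)
  IsHom-∘ pres hom F G F∈ G∈ = proj₁ pres ∘ proj₁ (hom F G F∈ G∈) , proj₂ pres ∘ proj₂ (hom F G F∈ G∈)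

  SeparatedBy : (Corner → Fin n) → (Subset n → C23) → Set
  SeparatedBy ℓ φ = ∀ F → InF _≼_ F → ∀ c → ℓ c ∈ F → ¬ Only c (φ F)

  SeparatingHomBy : (Corner → Fin n) → Set
  SeparatingHomBy ℓ = Σ (Subset n → C23) λ φ → IsHom _≼_ φ × SeparatedBy ℓ φ

  SeparatedBy-relabel : ∀ {σ ℓ ℓ' φ} π → ReflectsOnly σ π → (∀ c → ℓ' c ≡ ℓ (π c)) →
                        SeparatedBy ℓ φ → SeparatedBy ℓ' (σ ∘ φ)
  SeparatedBy-relabel {φ = φ} π reflects ℓ'≡ℓ∘π sep F F∈ c ℓ'c∈F only =
    sep F F∈ (π c) (subst (_∈ F) (ℓ'≡ℓ∘π c) ℓ'c∈F) (reflects (φ F) c only)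

  SeparatedBy⇒Separating : ∀ {a b v w x x' y y' φ} →
    x ≢ x' → IsMin _≼_ x → IsMin _≼_ x' → y ≢ y' → IsMax _≼_ y → IsMax _≼_ y' →
    quad x x' y y' ≡ quad a b v w → SeparatedBy (corner x x' y y') φ → Separating _≼_ a b v w φ
  SeparatedBy⇒Separating {x = x} {x'} {y} {y'} x≢x' min-x min-x' y≢y' max-y max-y' eq sep =
    x , x' , y , y' , x≢x' , min-x , min-x' , y≢y' , max-y , max-y' , eq ,
    λ F F∈ → sep F F∈ ca , sep F F∈ cb , sep F F∈ cv , sep F F∈ cw

  Separating⇒SeparatedBy : ∀ {a b v w φ} → (sep : Separating _≼_ a b v w φ) →
    let (x , x' , y , y' , _) = sep in SeparatedBy (corner x x' y y') φ
  Separating⇒SeparatedBy (_ , _ , _ , _ , _ , _ , _ , _ , _ , _ , _ , sep) F F∈ =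
    every-corner (proj₁ (sep F F∈)) (proj₁ (proj₂ (sep F F∈)))
                 (proj₁ (proj₂ (proj₂ (sep F F∈)))) (proj₂ (proj₂ (proj₂ (sep F F∈))))

  normaliseLower : ∀ {a b x x' y y'} → (x ≡ a × x' ≡ b) ⊎ (x ≡ b × x' ≡ a) →
                   SeparatingHomBy (corner x x' y y') → SeparatingHomBy (corner b a y y')
  normaliseLower (inj₁ (refl , refl)) (φ , hom , sep) =
    swapLower ∘ φ , IsHom-∘ swapLower-preservesEdges hom ,
    SeparatedBy-relabel swapLowerCorner swapLower-reflectsOnly (every-corner refl refl refl refl) sep
  normaliseLower (inj₂ (refl , refl)) φ = φ

  normaliseUpper : ∀ {v w x x' y y'} → (y ≡ v × y' ≡ w) ⊎ (y ≡ w × y' ≡ v) →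
                   SeparatingHomBy (corner x x' y y') → SeparatingHomBy (corner x x' w v)
  normaliseUpper (inj₁ (refl , refl)) (φ , hom , sep) =
    swapUpper ∘ φ , IsHom-∘ swapUpper-preservesEdges hom ,
    SeparatedBy-relabel swapUpperCorner swapUpper-reflectsOnly (every-corner refl refl refl refl) sep
  normaliseUpper (inj₂ (refl , refl)) φ = φ

  IntoC3⇒FixesC3 : ∀ {a b v w ψ} → IntoC3 _≼_ ψ → SeparatedBy (corner b a w v) ψ →
                   FixesC3 _≼_ a b v w ψ
  IntoC3⇒FixesC3 {a} {b} {v} {w} {ψ} intoC3 sep S S∈𝒞₃ F F∈ S⊆F =
    C3-pinned S (ψ F) S∈𝒞₃ (intoC3 F F∈) λ c c∈S →
      sep F F∈ (partner c)
        (subst (_∈ F) (sym (corner-partner a b v w c)) (S⊆F (has⇒corner-∈-toSub a b v w S c c∈S)))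

  InE⇒IsMin : ∀ {x y} → x ≼ y → x ≢ y → InE _≼_ x → IsMin _≼_ x
  InE⇒IsMin x≼y x≢y (inj₁ min) = min
  InE⇒IsMin x≼y x≢y (inj₂ max) = ⊥-elim (x≢y (sym (max _ x≼y)))

  InE⇒IsMax : ∀ {x y} → x ≼ y → x ≢ y → InE _≼_ y → IsMax _≼_ y
  InE⇒IsMax x≼y x≢y (inj₁ min) = ⊥-elim (x≢y (min _ x≼y))
  InE⇒IsMax x≼y x≢y (inj₂ max) = max

  module Crown {a b v w} (crown : Is4Crown _≼_ a b v w) where
    open Is4Crown crown

    IsMin-∈-quad : ∀ {x} → IsMin _≼_ x → x ∈ quad a b v w → x ≡ a ⊎ x ≡ b
    IsMin-∈-quad {x} min x∈ with ∈-quad⁻ a b v w x∈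
    ... | ca , x≡a = inj₁ x≡a
    ... | cb , x≡b = inj₂ x≡b
    ... | cv , refl = ⊥-elim (a≢v (min a a≤v))
    ... | cw , refl = ⊥-elim (a≢w (min a a≤w))

    IsMax-∈-quad : ∀ {y} → IsMax _≼_ y → y ∈ quad a b v w → y ≡ v ⊎ y ≡ w
    IsMax-∈-quad {y} max y∈ with ∈-quad⁻ a b v w y∈
    ... | ca , refl = ⊥-elim (a≢v (sym (max v a≤v)))
    ... | cb , refl = ⊥-elim (b≢v (sym (max v b≤v)))
    ... | cv , y≡v = inj₁ y≡v
    ... | cw , y≡w = inj₂ y≡w

    normalise : ∀ {φ} → IsHom _≼_ φ → Separating _≼_ a b v w φ →
                SeparatingHomBy (corner b a w v)
    normalise {φ} hom sep@(x , x' , y , y' , x≢x' , min-x , min-x' , y≢y' , max-y , max-y' , eq , _) =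
      normaliseUpper upper (normaliseLower lower (φ , hom , Separating⇒SeparatedBy sep))
      where
      corner-∈ : ∀ c → corner x x' y y' c ∈ quad a b v w
      corner-∈ c = subst (_ ∈_) eq (corner-∈-quad x x' y y' c)
      lower : (x ≡ a × x' ≡ b) ⊎ (x ≡ b × x' ≡ a)
      lower = distinct-in-pair x≢x' (IsMin-∈-quad min-x (corner-∈ ca)) (IsMin-∈-quad min-x' (corner-∈ cb))
      upper : (y ≡ v × y' ≡ w) ⊎ (y ≡ w × y' ≡ v)
      upper = distinct-in-pair y≢y' (IsMax-∈-quad max-y (corner-∈ cv)) (IsMax-∈-quad max-y' (corner-∈ cw))

    separatingHom⇒intoC3-fixing : InE _≼_ a → InE _≼_ b → InE _≼_ v → InE _≼_ w →
      (Σ (Subset n → C23) λ φ → IsHom _≼_ φ × Separating _≼_ a b v w φ) →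
      Σ (Subset n → C23) λ ψ → IsHom _≼_ ψ × IntoC3 _≼_ ψ
                              × Separating _≼_ a b v w ψ × FixesC3 _≼_ a b v w ψ
    separatingHom⇒intoC3-fixing a∈E b∈E v∈E w∈E (φ , hom , sep) with normalise hom sep
    ... | φ₀ , hom₀ , sep₀ = ψ , hom′ , intoC3 , separating , IntoC3⇒FixesC3 intoC3 sep′
      where
      ψ : Subset n → C23
      ψ = fillLower ∘ φ₀
      hom′ : IsHom _≼_ ψ
      hom′ = IsHom-∘ (Monotone⇒PreservesEdges fillLower-monotone) hom₀
      intoC3 : IntoC3 _≼_ ψ
      intoC3 F _ = fillLower-IsC3 (φ₀ F)
      sep′ : SeparatedBy (corner b a w v) ψ
      sep′ = SeparatedBy-relabel id fillLower-reflectsOnly (λ _ → refl) sep₀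
      separating : Separating _≼_ a b v w ψ
      separating =
        SeparatedBy⇒Separating (a≢b ∘ sym) (InE⇒IsMin b≤v b≢v b∈E) (InE⇒IsMin a≤v a≢v a∈E)
          (v≢w ∘ sym) (InE⇒IsMax a≤w a≢w w∈E) (InE⇒IsMax a≤v a≢v v∈E) (quad-swap a b v w) sep′

theorem3 : (n : ℕ) (_≼_ : Rel (Fin n) 0ℓ) → IsPartialOrder _≡_ _≼_ →
           Connected _≼_ → 2 ≤ n →
           (a b v w : Fin n) → Is4Crown _≼_ a b v w →
           InE _≼_ a → InE _≼_ b → InE _≼_ v → InE _≼_ w →
           ((Σ (Subset n → C23) λ φ → IsHom _≼_ φ × Separating _≼_ a b v w φ)
             ⇔ (Σ (Subset n → C23) λ ψ → IsHom _≼_ ψ × Separating _≼_ a b v w ψ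
                                            × FixesC3 _≼_ a b v w ψ))
           × ((Σ (Subset n → C23) λ φ → IsHom _≼_ φ × Separating _≼_ a b v w φ)
             ⇔ (Σ (Subset n → C23) λ ψ → IsHom _≼_ ψ × IntoC3 _≼_ ψ
                                            × Separating _≼_ a b v w ψ
                                            × FixesC3 _≼_ a b v w ψ))
theorem3 n _≼_ _ _ _ a b v w crown a∈E b∈E v∈E w∈E =
  mk⇔ (λ φ → let (ψ , hom , _ , sep , fixes) = improve a∈E b∈E v∈E w∈E φ in ψ , hom , sep , fixes)
      (λ (ψ , hom , sep , _) → ψ , hom , sep) ,
  mk⇔ (improve a∈E b∈E v∈E w∈E) (λ (ψ , hom , _ , sep , _) → ψ , hom , sep)
  where
  open Crown _≼_ crown renaming (separatingHom⇒intoC3-fixing to improve)
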